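{- Every symmetric stable matching instance has exactly one stable matching, and every execution of the mutual closest pair algorithm (regardless of which mutual closest pair is chosen at each step) outputs this matching. Mutual closest pair algorithm: start with the empty matching, all students unmatched and every school with its full quota remaining. While some student is unmatched: among the currently unmatched students and the schools with positive remaining quota, find any student $s$ and school $x$ such that $x$ is the closest such school to $s$ and $s$ is the closest such student to $x$; assign $s$ to $x$, decrease the remaining quota of $x$ by one, and remove $x$ from consideration if its remaining quota becomes zero.
   Context: A (one-to-many) stable matching instance consists of a set of $n$ students and a set of $m$ schools, each school having a positive integer quota, with the quotas summing to $n$. Each student gives a score to each school and each school gives a score to each student; each agent's scores for the agents of the opposite set are pairwise distinct, and each agent prefers agents of the opposite set in increasing order of score. The instance is symmetric if for every student $s$ and school $x$ the score of $s$ for $x$ equals the score of $x$ for $s$ (the distance between them). A matching assigns each student to exactly one school so that each school is assigned exactly its quota of students. It is stable if there is no student $s$ and school $x$ with $s$ not assigned to $x$ such that $s$ prefers $x$ to its assigned school and $x$ prefers $s$ to at least one of the students assigned to $x$. -}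

module Defs where

open import Level using (Level; _⊔_)
open import Data.Nat using (ℕ; zero; suc; _<_; pred)
open import Data.Fin using (Fin; _≟_)
open import Data.List using (List; length; filter; map; allFin)
open import Data.Nat.ListAction using (sum)
open import Data.Maybe using (Maybe; just; nothing)
open import Data.Product using (Σ; ∃; ∃-syntax; _×_; _,_)
open import Relation.Nullary using (¬_; yes; no)
open import Relation.Binary.PropositionalEquality using (_≡_; _≢_)
open import Relation.Binary.Bundles using (StrictTotalOrder)

-- Scores take values in an arbitrary strict total order O
-- (e.g. the reals); an agent prefers lower score.
module _ {a ℓ₁ ℓ₂ : Level} (O : StrictTotalOrder a ℓ₁ ℓ₂) where
  open StrictTotalOrder O using () renaming (Carrier to Score; _≈_ to _≈ₛ_; _<_ to _<ₛ_)

  record Instance (n m : ℕ) : Set (a ⊔ ℓ₁) where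
    field
      quota         : Fin m → ℕ
      quota-pos     : ∀ x → 0 < quota x
      quota-sum     : sum (map quota (allFin m)) ≡ n
      studentScore  : Fin n → Fin m → Score
      schoolScore   : Fin m → Fin n → Score
      studentScore-distinct : ∀ s x y → studentScore s x ≈ₛ studentScore s y → x ≡ y
      schoolScore-distinct  : ∀ x s t → schoolScore x s ≈ₛ schoolScore x t → s ≡ t

  module _ {n m : ℕ} (I : Instance n m) where
    open Instance I

    Symmetric : Set ℓ₁
    Symmetric = ∀ s x → studentScore s x ≈ₛ schoolScore x s

    load : (Fin n → Fin m) → Fin m → ℕ
    load μ x = length (filter (λ s → μ s ≟ x) (allFin n))

    IsMatching : (Fin n → Fin m) → Set
    IsMatching μ = ∀ x → load μ x ≡ quota x

    Blocking : (Fin n → Fin m) → Fin n → Fin m → Set ℓ₂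
    Blocking μ s x =
      μ s ≢ x × studentScore s x <ₛ studentScore s (μ s)
      × ∃[ t ] (μ t ≡ x × schoolScore x s <ₛ schoolScore x t)

    IsStable : (Fin n → Fin m) → Set ℓ₂
    IsStable μ = IsMatching μ × (∀ s x → ¬ Blocking μ s x)

    record State : Set where
      constructor ⟨_,_⟩
      field
        assign    : Fin n → Maybe (Fin m)
        remaining : Fin m → ℕ
    open State public

    initial : State
    initial = ⟨ (λ _ → nothing) , quota ⟩

    assignPair : State → Fin n → Fin m → State
    assignPair σ s x =
      ⟨ upd , rem′ ⟩
      where
        upd : Fin n → Maybe (Fin m)
        upd t with t ≟ s
        ... | yes _ = just x
        ... | no  _ = assign σ t
        rem′ : Fin m → ℕ
        rem′ y with y ≟ x
        ... | yes _ = pred (remaining σ x)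
        ... | no  _ = remaining σ y

    Unmatched : State → Fin n → Set
    Unmatched σ s = assign σ s ≡ nothing

    Available : State → Fin m → Set
    Available σ x = 0 < remaining σ x

    MutualClosest : State → Fin n → Fin m → Set ℓ₂
    MutualClosest σ s x =
      Unmatched σ s × Available σ x
      × (∀ y → Available σ y → y ≢ x → studentScore s x <ₛ studentScore s y)
      × (∀ t → Unmatched σ t → t ≢ s → schoolScore x s <ₛ schoolScore x t)

    data Step (σ : State) : State → Set (a ⊔ ℓ₂) where
      step : ∀ s x → MutualClosest σ s x → Step σ (assignPair σ s x)

    data Reachable : State → Set (a ⊔ ℓ₂) where
      start : Reachable initial
      next  : ∀ {σ σ′} → Reachable σ → Step σ σ′ → Reachable σ′

    AllMatched : State → Set
    AllMatched σ = ∀ s → ∃[ x ] assign σ s ≡ just x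

-- By induction along any run of the algorithm we maintain: each school prefers the
-- students it has admitted to every unmatched student, and a school that an assigned
-- student prefers to his own is full and prefers all of its students to him.  Counting
-- seats shows that the free capacity equals the number of unmatched students, so while
-- someone is unmatched some school has a free seat; by symmetry, the unmatched student
-- closest to an available school forms a mutual closest pair with that school, so a run
-- never gets stuck and ends in a stable matching.  Conversely a stable matching μ agrees
-- with every partial run: if the next pair (s, x) were not matched in μ, then the partner
-- of s in μ still has a free seat, and the quota of x forces some unmatched student to be
-- a partner of x in μ, so (s, x) would block μ.
module Submission where

open import Defs
open import Level using (Level)
open import Function using (_∘_; id)
open import Data.Bool using (if_then_else_)
open import Data.Nat using (ℕ; zero; suc; _+_; _≤_; _<_; z≤n; s≤s; pred; _<?_)
open import Data.Nat.Properties
  using (module ≤-Reasoning; ≤-refl; +-mono-≤; +-mono-<-≤; m≤m+n; m<n+m; n≤0⇒n≡0; <-irrefl;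
         +-comm; +-suc; +-identityʳ; +-cancelʳ-≡; suc-injective;
         +-0-commutativeMonoid; +-commutativeSemigroup)
import Data.Nat.ListAction as ListAction
open import Algebra.Properties.CommutativeMonoid.Sum +-0-commutativeMonoid
  using (sum; sum-syntax; sum-cong-≗; sum-remove; sum-replicate-zero; ∑-distrib-+; ∑-comm)
open import Algebra.Properties.CommutativeSemigroup +-commutativeSemigroup using (x∙yz≈y∙xz)
open import Data.Fin using (Fin; zero; suc; punchIn; _≟_)
open import Data.Fin.Properties using (punchInᵢ≢i; any?)
open import Data.List using (length; filter; tabulate)
open import Data.List.Properties using (map-tabulate)
open import Data.Maybe using (Maybe; just; nothing)
open import Data.Maybe.Properties using (≡-dec; just-injective)
open import Data.Product using (Σ; ∃; ∃₂; ∃-syntax; _×_; _,_; proj₁; proj₂)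
open import Data.Sum using (inj₁; inj₂)
open import Relation.Nullary using (¬_; Dec; yes; no; does; contradiction)
open import Relation.Nullary.Decidable using (_×-dec_)
open import Relation.Unary using (Pred; Decidable)
open import Relation.Binary.Definitions using (DecidableEquality)
open import Relation.Binary.Bundles using (StrictTotalOrder; DecTotalOrder; TotalPreorder)
open import Relation.Binary.PropositionalEquality
  using (_≡_; _≢_; refl; sym; trans; cong; cong₂; subst; subst₂; module ≡-Reasoning)

-- Defined through `does` only, so that ⟦ map′ f g P? ⟧ and ⟦ P? ⟧ agree definitionally.
⟦_⟧ : ∀ {p} {P : Set p} → Dec P → ℕ
⟦ P? ⟧ = if does P? then 1 else 0

⟦⟧-yes : ∀ {p} {P : Set p} (P? : Dec P) → P → ⟦ P? ⟧ ≡ 1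
⟦⟧-yes (yes _) _ = refl
⟦⟧-yes (no ¬p) p = contradiction p ¬p

⟦⟧-no : ∀ {p} {P : Set p} (P? : Dec P) → ¬ P → ⟦ P? ⟧ ≡ 0
⟦⟧-no (yes p) ¬p = contradiction p ¬p
⟦⟧-no (no _)  _  = refl

⟦⟧-positive : ∀ {p} {P : Set p} (P? : Dec P) → 0 < ⟦ P? ⟧ → P
⟦⟧-positive (yes p) _ = p

⟦⟧-mono : ∀ {p q} {P : Set p} {Q : Set q} (P? : Dec P) (Q? : Dec Q) →
          (P → Q) → ⟦ P? ⟧ ≤ ⟦ Q? ⟧
⟦⟧-mono (yes p) (yes _) _   = ≤-refl
⟦⟧-mono (yes p) (no ¬q) P→Q = contradiction (P→Q p) ¬q
⟦⟧-mono (no _)  _       _   = z≤n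

∑-mono-≤ : ∀ {k} {f g : Fin k → ℕ} → (∀ i → f i ≤ g i) →
           ∑[ i < k ] f i ≤ ∑[ i < k ] g i
∑-mono-≤ {zero}  _     = z≤n
∑-mono-≤ {suc k} f≤g = +-mono-≤ (f≤g zero) (∑-mono-≤ (f≤g ∘ suc))

term≤∑ : ∀ {k} (f : Fin k → ℕ) i → f i ≤ ∑[ j < k ] f j
term≤∑ {suc k} f i = subst (f i ≤_) (sym (sum-remove {i = i} f)) (m≤m+n (f i) _)

∑-mono-< : ∀ {k} {f g : Fin k → ℕ} → (∀ i → f i ≤ g i) → ∀ i → f i < g i →
           ∑[ j < k ] f j < ∑[ j < k ] g j
∑-mono-< {suc k} {f} {g} f≤g i fi<gi = begin-strict
  sum f                           ≡⟨ sum-remove {i = i} f ⟩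
  f i + sum (f ∘ punchIn i)       <⟨ +-mono-<-≤ fi<gi (∑-mono-≤ (f≤g ∘ punchIn i)) ⟩
  g i + sum (g ∘ punchIn i)       ≡⟨ sum-remove {i = i} g ⟨
  sum g                           ∎
  where open ≤-Reasoning

∑-positive : ∀ {k} (f : Fin k → ℕ) → 0 < ∑[ i < k ] f i → ∃ λ i → 0 < f i
∑-positive {suc k} f 0<∑ with f zero in eq
... | suc _ = zero , subst (0 <_) (sym eq) (s≤s z≤n)
... | zero  with ∑-positive (f ∘ suc) 0<∑
...   | i , 0<fi = suc i , 0<fi

∑≡0 : ∀ {k} (f : Fin k → ℕ) → ∑[ i < k ] f i ≡ 0 → ∀ i → f i ≡ 0
∑≡0 f ∑f≡0 i = n≤0⇒n≡0 (subst (f i ≤_) ∑f≡0 (term≤∑ f i))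

∑-ones : ∀ k → ∑[ i < k ] 1 ≡ k
∑-ones zero    = refl
∑-ones (suc k) = cong suc (∑-ones k)

∑-update : ∀ {k} (f g : Fin k → ℕ) i → (∀ j → j ≢ i → f j ≡ g j) →
           g i + ∑[ j < k ] f j ≡ f i + ∑[ j < k ] g j
∑-update {suc k} f g i f≗g = begin
  g i + sum f                         ≡⟨ cong (g i +_) (sum-remove {i = i} f) ⟩
  g i + (f i + sum (f ∘ punchIn i))   ≡⟨ x∙yz≈y∙xz (g i) (f i) _ ⟩
  f i + (g i + sum (f ∘ punchIn i))   ≡⟨ cong (λ r → f i + (g i + r)) (sum-cong-≗ rest-agree) ⟩
  f i + (g i + sum (g ∘ punchIn i))   ≡⟨ cong (f i +_) (sum-remove {i = i} g) ⟨
  f i + sum g                         ∎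
  where
  open ≡-Reasoning
  rest-agree : ∀ j → f (punchIn i j) ≡ g (punchIn i j)
  rest-agree j = f≗g _ (punchInᵢ≢i i j)

∑-indicator-unique : ∀ {k p} {P : Pred (Fin k) p} (P? : Decidable P) i →
                     P i → (∀ j → P j → j ≡ i) → ∑[ j < k ] ⟦ P? j ⟧ ≡ 1
∑-indicator-unique {suc k} P? i Pi unique = begin
  sum (⟦_⟧ ∘ P?)                          ≡⟨ sum-remove {i = i} (⟦_⟧ ∘ P?) ⟩
  ⟦ P? i ⟧ + sum (⟦_⟧ ∘ P? ∘ punchIn i)
    ≡⟨ cong₂ _+_ (⟦⟧-yes (P? i) Pi) (sum-cong-≗ others) ⟩
  1 + sum {k} (λ _ → 0)                   ≡⟨ cong suc (sum-replicate-zero k) ⟩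
  1                                       ∎
  where
  open ≡-Reasoning
  others : ∀ j → ⟦ P? (punchIn i j) ⟧ ≡ 0
  others j = ⟦⟧-no (P? (punchIn i j)) (punchInᵢ≢i i j ∘ unique _)

sum-tabulate : ∀ {k} (f : Fin k → ℕ) → ListAction.sum (tabulate f) ≡ ∑[ i < k ] f i
sum-tabulate {zero}  f = refl
sum-tabulate {suc k} f = cong (f zero +_) (sum-tabulate (f ∘ suc))

length-filter-tabulate : ∀ {k a p} {A : Set a} {P : Pred A p} (P? : Decidable P) (f : Fin k → A) →
                         length (filter P? (tabulate f)) ≡ ∑[ i < k ] ⟦ P? (f i) ⟧
length-filter-tabulate {zero}  P? f = refl
length-filter-tabulate {suc k} P? f with P? (f zero)
... | yes _ = cong suc (length-filter-tabulate P? (f ∘ suc))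
... | no  _ = length-filter-tabulate P? (f ∘ suc)

module _ {c ℓ₁ ℓ₂} (T : TotalPreorder c ℓ₁ ℓ₂) where
  open TotalPreorder T using (Carrier; _≲_; total) renaming (refl to ≲-refl; trans to ≲-trans)

  argmin : ∀ {k p} {P : Pred (Fin k) p} → Decidable P → (f : Fin k → Carrier) →
           ∃ P → ∃ λ i → P i × (∀ j → P j → f i ≲ f j)
  argmin {suc k} {P = P} P? f w with any? (P? ∘ suc)
  ... | no ¬Ptail = zero , P0 w , λ where
        zero    _  → ≲-refl
        (suc j) Pj → contradiction (j , Pj) ¬Ptail
    where
    P0 : ∃ P → P zero
    P0 (zero  , P0) = P0
    P0 (suc i , Pi) = contradiction (i , Pi) ¬Ptail
  ... | yes Ptail with argmin (P? ∘ suc) (f ∘ suc) Ptail | P? zero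
  ...   | i , Pi , min | no ¬P0 = suc i , Pi , λ where
          zero    P0 → contradiction P0 ¬P0
          (suc j) Pj → min j Pj
  ...   | i , Pi , min | yes P0 with total (f zero) (f (suc i))
  ...     | inj₁ f0≲fi = zero , P0 , λ where
            zero    _  → ≲-refl
            (suc j) Pj → ≲-trans f0≲fi (min j Pj)
  ...     | inj₂ fi≲f0 = suc i , Pi , λ where
            zero    _  → fi≲f0
            (suc j) Pj → min j Pj

module MutualClosestPairs {a ℓ₁ ℓ₂ : Level} (O : StrictTotalOrder a ℓ₁ ℓ₂)
                          {n m : ℕ} (I : Instance O n m) where
  open StrictTotalOrder O using (asym) renaming (Carrier to Score; _<_ to _<ₛ_; _≈_ to _≈ₛ_)
  open import Relation.Binary.Properties.StrictTotalOrder O using (decTotalOrder)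
  open DecTotalOrder decTotalOrder using (totalPreorder; preorder) renaming (_≤_ to _≤ₛ_)
  open Instance I
  open State

  _≟ₘ_ : DecidableEquality (Maybe (Fin m))
  _≟ₘ_ = ≡-dec _≟_

  assignedCount : State O I → Maybe (Fin m) → ℕ
  assignedCount σ v = ∑[ t < n ] ⟦ assign σ t ≟ₘ v ⟧

  unmatchedCount : State O I → ℕ
  unmatchedCount σ = assignedCount σ nothing

  module _ (σ : State O I) (s : Fin n) (x : Fin m) where
    private
      σ′ : State O I
      σ′ = assignPair O I σ s x

    assign-assignPair-self : assign σ′ s ≡ just x
    assign-assignPair-self with s ≟ s
    ... | yes _   = refl
    ... | no s≢s = contradiction refl s≢s

    assign-assignPair-other : ∀ {t} → t ≢ s → assign σ′ t ≡ assign σ t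
    assign-assignPair-other {t} t≢s with t ≟ s
    ... | yes t≡s = contradiction t≡s t≢s
    ... | no _    = refl

    remaining-assignPair-self : remaining σ′ x ≡ pred (remaining σ x)
    remaining-assignPair-self with x ≟ x
    ... | yes _   = refl
    ... | no x≢x = contradiction refl x≢x

    remaining-assignPair-other : ∀ {y} → y ≢ x → remaining σ′ y ≡ remaining σ y
    remaining-assignPair-other {y} y≢x with y ≟ x
    ... | yes y≡x = contradiction y≡x y≢x
    ... | no _    = refl

    assignedCount-assignPair : Unmatched O I σ s → ∀ v →
      ⟦ nothing ≟ₘ v ⟧ + assignedCount σ′ v ≡ ⟦ just x ≟ₘ v ⟧ + assignedCount σ v
    assignedCount-assignPair s-unmatched v = begin
      ⟦ nothing ≟ₘ v ⟧ + assignedCount σ′ v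
        ≡⟨ cong (λ w → ⟦ w ≟ₘ v ⟧ + assignedCount σ′ v) s-unmatched ⟨
      ⟦ assign σ s ≟ₘ v ⟧ + assignedCount σ′ v
        ≡⟨ ∑-update _ _ s unchanged ⟩
      ⟦ assign σ′ s ≟ₘ v ⟧ + assignedCount σ v
        ≡⟨ cong (λ w → ⟦ w ≟ₘ v ⟧ + assignedCount σ v) assign-assignPair-self ⟩
      ⟦ just x ≟ₘ v ⟧ + assignedCount σ v
        ∎
      where
      open ≡-Reasoning
      unchanged : ∀ t → t ≢ s → ⟦ assign σ′ t ≟ₘ v ⟧ ≡ ⟦ assign σ t ≟ₘ v ⟧
      unchanged t t≢s = cong (λ w → ⟦ w ≟ₘ v ⟧) (assign-assignPair-other t≢s)

  slots-partition : ∀ v → ∑[ x < m ] ⟦ v ≟ₘ just x ⟧ + ⟦ v ≟ₘ nothing ⟧ ≡ 1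
  slots-partition nothing  = cong (_+ 1) (sum-replicate-zero m)
  slots-partition (just y) = trans (+-identityʳ _) (∑-indicator-unique (y ≟_) y refl (λ _ → sym))

  record Invariant (σ : State O I) : Set ℓ₂ where
    field
      quota-split : ∀ x → remaining σ x + assignedCount σ (just x) ≡ quota x
      admitted-beat-unmatched : ∀ {t x u} → assign σ t ≡ just x → Unmatched O I σ u →
                                schoolScore x t <ₛ schoolScore x u
      preferred-full : ∀ {s y x} → assign σ s ≡ just y → studentScore s x <ₛ studentScore s y →
                       remaining σ x ≡ 0
      preferred-rejects : ∀ {s y x t} → assign σ s ≡ just y →
                          studentScore s x <ₛ studentScore s y →
                          assign σ t ≡ just x → schoolScore x t <ₛ schoolScore x s
  open Invariant

  invariant-initial : Invariant (initial O I)
  invariant-initial .quota-split x =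
    trans (cong (quota x +_) (sum-replicate-zero n)) (+-identityʳ (quota x))
  invariant-initial .admitted-beat-unmatched ()
  invariant-initial .preferred-full ()
  invariant-initial .preferred-rejects ()

  module _ {σ : State O I} {s₀ : Fin n} {x₀ : Fin m}
           (closest : MutualClosest O I σ s₀ x₀) where
    private
      σ′ : State O I
      σ′ = assignPair O I σ s₀ x₀

      s₀-unmatched : Unmatched O I σ s₀
      s₀-unmatched = proj₁ closest

      x₀-available : Available O I σ x₀
      x₀-available = proj₁ (proj₂ closest)

      x₀-closest-to-s₀ : ∀ y → Available O I σ y → y ≢ x₀ →
                         studentScore s₀ x₀ <ₛ studentScore s₀ y
      x₀-closest-to-s₀ = proj₁ (proj₂ (proj₂ closest))

      s₀-closest-to-x₀ : ∀ t → Unmatched O I σ t → t ≢ s₀ →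
                         schoolScore x₀ s₀ <ₛ schoolScore x₀ t
      s₀-closest-to-x₀ = proj₂ (proj₂ (proj₂ closest))

      assigned-before : ∀ {t v} → t ≢ s₀ → assign σ′ t ≡ v → assign σ t ≡ v
      assigned-before t≢s₀ = trans (sym (assign-assignPair-other σ s₀ x₀ t≢s₀))

      assigned-s₀ : ∀ {x} → assign σ′ s₀ ≡ just x → x ≡ x₀
      assigned-s₀ eq = just-injective (trans (sym eq) (assign-assignPair-self σ s₀ x₀))

    unmatchedCount-step : suc (unmatchedCount σ′) ≡ unmatchedCount σ
    unmatchedCount-step = assignedCount-assignPair σ s₀ x₀ s₀-unmatched nothing

    -- Case splits below go through a helper on `Dec` rather than `with t ≟ s₀`: a `with`
    -- would also abstract the identical test inside `assignPair`, in the goal and hypotheses.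
    module _ (inv : Invariant σ) where
      quota-split-self : remaining σ′ x₀ + assignedCount σ′ (just x₀) ≡ quota x₀
      quota-split-self = begin
        remaining σ′ x₀ + assignedCount σ′ (just x₀)
          ≡⟨ cong₂ _+_ (remaining-assignPair-self σ s₀ x₀) enrolled-self ⟩
        pred (remaining σ x₀) + suc (assignedCount σ (just x₀))
          ≡⟨ pred+suc (remaining σ x₀) _ x₀-available ⟩
        remaining σ x₀ + assignedCount σ (just x₀)
          ≡⟨ quota-split inv x₀ ⟩
        quota x₀
          ∎
        where
        open ≡-Reasoning
        enrolled-self : assignedCount σ′ (just x₀) ≡ suc (assignedCount σ (just x₀))
        enrolled-self = trans (assignedCount-assignPair σ s₀ x₀ s₀-unmatched (just x₀))
                              (cong (_+ assignedCount σ (just x₀)) (⟦⟧-yes (x₀ ≟ x₀) refl))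
        pred+suc : ∀ r c → 0 < r → pred r + suc c ≡ r + c
        pred+suc (suc r) c _ = +-suc r c

      quota-split-other : ∀ {x} → x ≢ x₀ →
                          remaining σ′ x + assignedCount σ′ (just x) ≡ quota x
      quota-split-other {x} x≢x₀ = begin
        remaining σ′ x + assignedCount σ′ (just x)
          ≡⟨ cong₂ _+_ (remaining-assignPair-other σ s₀ x₀ x≢x₀) enrolled-other ⟩
        remaining σ x + assignedCount σ (just x)
          ≡⟨ quota-split inv x ⟩
        quota x
          ∎
        where
        open ≡-Reasoning
        enrolled-other : assignedCount σ′ (just x) ≡ assignedCount σ (just x)
        enrolled-other = trans (assignedCount-assignPair σ s₀ x₀ s₀-unmatched (just x))
                               (cong (_+ assignedCount σ (just x)) (⟦⟧-no (x₀ ≟ x) (x≢x₀ ∘ sym)))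

      admitted-beat-unmatched-step : ∀ {t x u} → assign σ′ t ≡ just x → Unmatched O I σ′ u →
                                     schoolScore x t <ₛ schoolScore x u
      admitted-beat-unmatched-step {t} {x} {u} t↦x u-unmatched′ = by-cases (u ≟ s₀) (t ≟ s₀)
        where
        by-cases : Dec (u ≡ s₀) → Dec (t ≡ s₀) → schoolScore x t <ₛ schoolScore x u
        by-cases (yes refl) _ =
          contradiction (trans (sym u-unmatched′) (assign-assignPair-self σ s₀ x₀)) λ ()
        by-cases (no u≢s₀) (yes refl) rewrite assigned-s₀ t↦x =
          s₀-closest-to-x₀ u (assigned-before u≢s₀ u-unmatched′) u≢s₀
        by-cases (no u≢s₀) (no t≢s₀) =
          admitted-beat-unmatched inv (assigned-before t≢s₀ t↦x) (assigned-before u≢s₀ u-unmatched′)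

      preferred-was-full : ∀ {s y x} → assign σ′ s ≡ just y →
                           studentScore s x <ₛ studentScore s y → remaining σ x ≡ 0
      preferred-was-full {s} {y} {x} s↦y x<y = by-cases (s ≟ s₀)
        where
        by-cases : Dec (s ≡ s₀) → remaining σ x ≡ 0
        by-cases (no s≢s₀)  = preferred-full inv (assigned-before s≢s₀ s↦y) x<y
        by-cases (yes refl) with remaining σ x in eq
        ... | zero  = refl
        ... | suc _ = contradiction (x₀-closest-to-s₀ x x-available x≢x₀) (asym x<x₀)
          where
          x-available : Available O I σ x
          x-available = subst (0 <_) (sym eq) (s≤s z≤n)
          x<x₀ : studentScore s x <ₛ studentScore s x₀
          x<x₀ = subst (λ z → studentScore s x <ₛ studentScore s z) (assigned-s₀ s↦y) x<y
          x≢x₀ : x ≢ x₀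
          x≢x₀ refl = asym x<x₀ x<x₀

      preferred-not-x₀ : ∀ {s y x} → assign σ′ s ≡ just y →
                         studentScore s x <ₛ studentScore s y → x ≢ x₀
      preferred-not-x₀ s↦y x<y refl =
        <-irrefl refl (subst (0 <_) (preferred-was-full s↦y x<y) x₀-available)

      preferred-rejects-step : ∀ {s y x t} → assign σ′ s ≡ just y →
                               studentScore s x <ₛ studentScore s y →
                               assign σ′ t ≡ just x → schoolScore x t <ₛ schoolScore x s
      preferred-rejects-step {s} {y} {x} {t} s↦y x<y t↦x = by-cases (s ≟ s₀)
        where
        t≢s₀ : t ≢ s₀
        t≢s₀ refl = preferred-not-x₀ s↦y x<y (assigned-s₀ t↦x)
        by-cases : Dec (s ≡ s₀) → schoolScore x t <ₛ schoolScore x s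
        by-cases (yes refl) =
          admitted-beat-unmatched inv (assigned-before t≢s₀ t↦x) s₀-unmatched
        by-cases (no s≢s₀)  =
          preferred-rejects inv (assigned-before s≢s₀ s↦y) x<y (assigned-before t≢s₀ t↦x)

      invariant-step : Invariant σ′
      invariant-step .quota-split x = by-cases (x ≟ x₀)
        where
        by-cases : Dec (x ≡ x₀) → remaining σ′ x + assignedCount σ′ (just x) ≡ quota x
        by-cases (yes refl) = quota-split-self
        by-cases (no x≢x₀)  = quota-split-other x≢x₀
      invariant-step .admitted-beat-unmatched = admitted-beat-unmatched-step
      invariant-step .preferred-full s↦y x<y =
        trans (remaining-assignPair-other σ s₀ x₀ (preferred-not-x₀ s↦y x<y))
              (preferred-was-full s↦y x<y)
      invariant-step .preferred-rejects = preferred-rejects-step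

  reachable-invariant : ∀ {σ} → Reachable O I σ → Invariant σ
  reachable-invariant start                           = invariant-initial
  reachable-invariant (next reach (step _ _ closest)) =
    invariant-step closest (reachable-invariant reach)

  quota-total : ∑[ x < m ] quota x ≡ n
  quota-total =
    trans (sym (trans (cong ListAction.sum (map-tabulate id quota)) (sum-tabulate quota))) quota-sum

  remaining-total : ∀ {σ} → Invariant σ → ∑[ x < m ] remaining σ x ≡ unmatchedCount σ
  remaining-total {σ} inv = +-cancelʳ-≡ matched _ _ (begin
    ∑[ x < m ] remaining σ x + matched                      ≡⟨ ∑-distrib-+ (remaining σ) _ ⟨
    ∑[ x < m ] (remaining σ x + assignedCount σ (just x))   ≡⟨ sum-cong-≗ (quota-split inv) ⟩
    ∑[ x < m ] quota x                                      ≡⟨ quota-total ⟩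
    n                                                       ≡⟨ ∑-ones n ⟨
    ∑[ t < n ] 1                                            ≡⟨ sum-cong-≗ (slots-partition ∘ assign σ) ⟨
    ∑[ t < n ] (isAssigned t + isUnmatched t)               ≡⟨ ∑-distrib-+ isAssigned isUnmatched ⟩
    ∑[ t < n ] isAssigned t + unmatchedCount σ
                                              ≡⟨ cong (_+ unmatchedCount σ) (∑-comm assigned-to) ⟩
    matched + unmatchedCount σ                              ≡⟨ +-comm matched _ ⟩
    unmatchedCount σ + matched                              ∎)
    where
    open ≡-Reasoning
    assigned-to : Fin n → Fin m → ℕ
    assigned-to t x = ⟦ assign σ t ≟ₘ just x ⟧
    isAssigned isUnmatched : Fin n → ℕ
    isAssigned t = ∑[ x < m ] assigned-to t x
    isUnmatched t = ⟦ assign σ t ≟ₘ nothing ⟧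
    matched : ℕ
    matched = ∑[ x < m ] assignedCount σ (just x)

  -- Progress and termination

  unmatchedCount-positive : ∀ {σ s} → Unmatched O I σ s → 0 < unmatchedCount σ
  unmatchedCount-positive {σ} {s} s-unmatched =
    subst (_≤ unmatchedCount σ) (⟦⟧-yes (assign σ s ≟ₘ nothing) s-unmatched) (term≤∑ _ s)

  available-exists : ∀ {σ} → Invariant σ → ∃ (Unmatched O I σ) → ∃ (Available O I σ)
  available-exists {σ} inv (s , s-unmatched) =
    ∑-positive (remaining σ)
      (subst (0 <_) (sym (remaining-total inv)) (unmatchedCount-positive {σ} s-unmatched))

  <-if-≤-≉ : ∀ {p q} → p ≤ₛ q → ¬ p ≈ₛ q → p <ₛ q
  <-if-≤-≉ (inj₁ p<q) _   = p<q
  <-if-≤-≉ (inj₂ p≈q) p≉q = contradiction p≈q p≉q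

  mutual-closest-exists : Symmetric O I → ∀ {σ} → Invariant σ → ∃ (Unmatched O I σ) →
                          ∃₂ (MutualClosest O I σ)
  mutual-closest-exists symmetric {σ} inv unmatched =
    s* , x* , s*-unmatched , x*-available , x*-closest-to-s* , s*-closest-to-x*
    where
    closest : ∀ s → ∃ λ x → Available O I σ x ×
                            (∀ y → Available O I σ y → studentScore s x ≤ₛ studentScore s y)
    closest s =
      argmin totalPreorder (λ y → 0 <? remaining σ y) (studentScore s) (available-exists inv unmatched)

    distance : Fin n → Score
    distance s = studentScore s (proj₁ (closest s))

    nearest : ∃ λ s → Unmatched O I σ s × (∀ t → Unmatched O I σ t → distance s ≤ₛ distance t)
    nearest = argmin totalPreorder (λ t → assign σ t ≟ₘ nothing) distance unmatched

    s* : Fin n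
    s* = proj₁ nearest

    s*-unmatched : Unmatched O I σ s*
    s*-unmatched = proj₁ (proj₂ nearest)

    x* : Fin m
    x* = proj₁ (closest s*)

    x*-available : Available O I σ x*
    x*-available = proj₁ (proj₂ (closest s*))

    x*-closest-to-s* : ∀ y → Available O I σ y → y ≢ x* →
                       studentScore s* x* <ₛ studentScore s* y
    x*-closest-to-s* y y-available y≢x* =
      <-if-≤-≉ (proj₂ (proj₂ (closest s*)) y y-available)
               (y≢x* ∘ sym ∘ studentScore-distinct s* x* y)

    s*-closest-to-x* : ∀ t → Unmatched O I σ t → t ≢ s* →
                       schoolScore x* s* <ₛ schoolScore x* t
    s*-closest-to-x* t t-unmatched t≢s* =
      <-if-≤-≉ x*-prefers-s* (t≢s* ∘ sym ∘ schoolScore-distinct x* s* t)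
      where
      open import Relation.Binary.Reasoning.Preorder preorder
      x*-prefers-s* : schoolScore x* s* ≤ₛ schoolScore x* t
      x*-prefers-s* = begin
        schoolScore x* s*  ≈⟨ symmetric s* x* ⟨
        distance s*        ≲⟨ proj₂ (proj₂ nearest) t t-unmatched ⟩
        distance t         ≲⟨ proj₂ (proj₂ (closest t)) x* x*-available ⟩
        studentScore t x*  ≈⟨ symmetric t x* ⟩
        schoolScore x* t   ∎

  runs-to-completion : Symmetric O I → ∀ {σ} → Reachable O I σ →
                       ∃ λ σ′ → Reachable O I σ′ × AllMatched O I σ′
  runs-to-completion symmetric reach = run _ reach refl
    where
    assigned-if-uncounted : ∀ v → ⟦ v ≟ₘ nothing ⟧ ≡ 0 → ∃ λ x → v ≡ just x
    assigned-if-uncounted (just x) _ = x , refl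

    run : ∀ k {σ} → Reachable O I σ → unmatchedCount σ ≡ k →
          ∃ λ σ′ → Reachable O I σ′ × AllMatched O I σ′
    run zero    {σ} reach none-unmatched =
      σ , reach , λ s → assigned-if-uncounted (assign σ s) (∑≡0 _ none-unmatched s)
    run (suc k) {σ} reach count≡1+k with ∑-positive _ (subst (0 <_) (sym count≡1+k) (s≤s z≤n))
    ... | s , s-counted with mutual-closest-exists symmetric (reachable-invariant reach)
                               (s , ⟦⟧-positive (assign σ s ≟ₘ nothing) s-counted)
    ... | s₀ , x₀ , closest =
      run k (next reach (step s₀ x₀ closest))
            (suc-injective (trans (unmatchedCount-step closest) count≡1+k))

  module _ {σ : State O I} (reach : Reachable O I σ) (complete : AllMatched O I σ) where
    outcome : Fin n → Fin m
    outcome s = proj₁ (complete s)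

    private
      assign-outcome : ∀ s → assign σ s ≡ just (outcome s)
      assign-outcome s = proj₂ (complete s)

      inv : Invariant σ
      inv = reachable-invariant reach

      remaining-zero : ∀ x → remaining σ x ≡ 0
      remaining-zero = ∑≡0 (remaining σ) (begin
        ∑[ x < m ] remaining σ x   ≡⟨ remaining-total inv ⟩
        unmatchedCount σ           ≡⟨ sum-cong-≗ (cong (λ w → ⟦ w ≟ₘ nothing ⟧) ∘ assign-outcome) ⟩
        ∑[ t < n ] 0               ≡⟨ sum-replicate-zero n ⟩
        0                          ∎)
        where open ≡-Reasoning

    outcome-stable : IsStable O I outcome
    outcome-stable = matching , no-blocking
      where
      matching : IsMatching O I outcome
      matching x = begin
        load O I outcome x                       ≡⟨ length-filter-tabulate (λ s → outcome s ≟ x) id ⟩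
        ∑[ t < n ] ⟦ outcome t ≟ x ⟧
          ≡⟨ sum-cong-≗ (cong (λ w → ⟦ w ≟ₘ just x ⟧) ∘ assign-outcome) ⟨
        assignedCount σ (just x)                 ≡⟨ cong (_+ assignedCount σ (just x)) (remaining-zero x) ⟨
        remaining σ x + assignedCount σ (just x) ≡⟨ quota-split inv x ⟩
        quota x                                  ∎
        where open ≡-Reasoning
      no-blocking : ∀ s x → ¬ Blocking O I outcome s x
      no-blocking s x (_ , x<μs , t , μt≡x , s<t) =
        asym s<t (preferred-rejects inv (assign-outcome s) x<μs (trans (assign-outcome t) (cong just μt≡x)))

  -- Stable matchings extend every partial run

  _⊑_ : State O I → (Fin n → Fin m) → Set
  σ ⊑ μ = ∀ {t x} → assign σ t ≡ just x → μ t ≡ x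

  module _ {μ : Fin n → Fin m} (μ-stable : IsStable O I μ)
           {σ : State O I} (inv : Invariant σ) (σ⊑μ : σ ⊑ μ) where
    private
      load≡quota : ∀ x → ∑[ t < n ] ⟦ μ t ≟ x ⟧ ≡ quota x
      load≡quota x = trans (sym (length-filter-tabulate (λ s → μ s ≟ x) id)) (proj₁ μ-stable x)

    stable-partner-available : ∀ {s} → Unmatched O I σ s → Available O I σ (μ s)
    stable-partner-available {s} s-unmatched = positive-if-short (quota-split inv (μ s)) (begin-strict
      assignedCount σ (just (μ s))   <⟨ ∑-mono-< sub-μ s s-strict ⟩
      ∑[ t < n ] ⟦ μ t ≟ μ s ⟧       ≡⟨ load≡quota (μ s) ⟩
      quota (μ s)                    ∎)
      where
      open ≤-Reasoning
      sub-μ : ∀ t → ⟦ assign σ t ≟ₘ just (μ s) ⟧ ≤ ⟦ μ t ≟ μ s ⟧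
      sub-μ t = ⟦⟧-mono (assign σ t ≟ₘ just (μ s)) (μ t ≟ μ s) σ⊑μ
      positive-if-short : ∀ {r c q} → r + c ≡ q → c < q → 0 < r
      positive-if-short {zero}  refl c<c = contradiction c<c (<-irrefl refl)
      positive-if-short {suc r} _    _   = s≤s z≤n
      s-strict : ⟦ assign σ s ≟ₘ just (μ s) ⟧ < ⟦ μ s ≟ μ s ⟧
      s-strict rewrite s-unmatched | ⟦⟧-yes (μ s ≟ μ s) refl = s≤s z≤n

    unmatched-partner : ∀ {x} → Available O I σ x → ∃ λ t → Unmatched O I σ t × μ t ≡ x
    unmatched-partner {x} x-available with any? (λ t → (assign σ t ≟ₘ nothing) ×-dec (μ t ≟ x))
    ... | yes partner = partner
    ... | no  none    = contradiction (begin-strict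
      quota x                                   ≡⟨ load≡quota x ⟨
      ∑[ t < n ] ⟦ μ t ≟ x ⟧                    ≤⟨ ∑-mono-≤ sub-σ ⟩
      assignedCount σ (just x)                  <⟨ m<n+m _ x-available ⟩
      remaining σ x + assignedCount σ (just x)  ≡⟨ quota-split inv x ⟩
      quota x                                   ∎) (<-irrefl refl)
      where
      open ≤-Reasoning
      admitted : ∀ t → μ t ≡ x → assign σ t ≡ just x
      admitted t μt≡x with assign σ t in t↦
      ... | nothing = contradiction (t , t↦ , μt≡x) none
      ... | just y  = cong just (trans (sym (σ⊑μ t↦)) μt≡x)
      sub-σ : ∀ t → ⟦ μ t ≟ x ⟧ ≤ ⟦ assign σ t ≟ₘ just x ⟧
      sub-σ t = ⟦⟧-mono (μ t ≟ x) (assign σ t ≟ₘ just x) (admitted t)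

    stable-matches-mutual-closest : ∀ {s₀ x₀} → MutualClosest O I σ s₀ x₀ → μ s₀ ≡ x₀
    stable-matches-mutual-closest {s₀} {x₀} (s₀-unmatched , x₀-available , x₀-closest , s₀-closest)
      with μ s₀ ≟ x₀
    ... | yes μs₀≡x₀ = μs₀≡x₀
    ... | no  μs₀≢x₀ with unmatched-partner x₀-available
    ...   | t , t-unmatched , μt≡x₀ = contradiction blocking (proj₂ μ-stable s₀ x₀)
      where
      t≢s₀ : t ≢ s₀
      t≢s₀ refl = μs₀≢x₀ μt≡x₀
      blocking : Blocking O I μ s₀ x₀
      blocking = μs₀≢x₀ , x₀-closest (μ s₀) (stable-partner-available s₀-unmatched) μs₀≢x₀
               , t , μt≡x₀ , s₀-closest t t-unmatched t≢s₀

  reachable-⊑-stable : ∀ {μ σ} → IsStable O I μ → Reachable O I σ → σ ⊑ μ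
  reachable-⊑-stable μ-stable start ()
  reachable-⊑-stable {μ} μ-stable (next {σ} reach (step s₀ x₀ closest)) {t} {x} t↦x =
    by-cases (t ≟ s₀)
    where
    σ⊑μ : σ ⊑ μ
    σ⊑μ = reachable-⊑-stable μ-stable reach
    by-cases : Dec (t ≡ s₀) → μ t ≡ x
    by-cases (yes refl) =
      trans (stable-matches-mutual-closest μ-stable (reachable-invariant reach) σ⊑μ closest)
            (just-injective (trans (sym (assign-assignPair-self σ t x₀)) t↦x))
    by-cases (no t≢s₀)  = σ⊑μ (trans (sym (assign-assignPair-other σ s₀ x₀ t≢s₀)) t↦x)

theorem2p6 : ∀ {a ℓ₁ ℓ₂ : Level} (O : StrictTotalOrder a ℓ₁ ℓ₂) {n m : ℕ}
    (I : Instance O n m) → Symmetric O I →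
    Σ (Fin n → Fin m) (λ μ →
    IsStable O I μ
    × (∀ μ′ → IsStable O I μ′ → ∀ s → μ′ s ≡ μ s)
    × (∀ σ → Reachable O I σ → AllMatched O I σ → ∀ s → State.assign σ s ≡ just (μ s))
    × (∀ σ → Reachable O I σ → (∃[ s ] Unmatched O I σ s) → ∃[ σ′ ] Step O I σ σ′))
theorem2p6 O {n} {m} I symmetric with MutualClosestPairs.runs-to-completion O I symmetric start
... | _ , reach , complete = μ , outcome-stable reach complete , unique , output , progress
  where
  open MutualClosestPairs O I

  μ : Fin n → Fin m
  μ = outcome reach complete

  unique : ∀ μ′ → IsStable O I μ′ → ∀ s → μ′ s ≡ μ s
  unique μ′ μ′-stable s = reachable-⊑-stable μ′-stable reach (proj₂ (complete s))

  output : ∀ σ → Reachable O I σ → AllMatched O I σ → ∀ s → State.assign σ s ≡ just (μ s)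
  output σ reach-σ complete-σ s with complete-σ s
  ... | x , s↦x =
    trans s↦x (cong just (sym (reachable-⊑-stable (outcome-stable reach complete) reach-σ s↦x)))

  progress : ∀ σ → Reachable O I σ → (∃[ s ] Unmatched O I σ s) → ∃[ σ′ ] Step O I σ σ′
  progress σ reach-σ unmatched with mutual-closest-exists symmetric (reachable-invariant reach-σ) unmatched
  ... | s , x , closest = _ , step s x closest
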